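{- If $n > 1$ is an integer, then \[ \sum_{d=1}^{n+1} \mu(d)\, 2^{\lfloor (n+1)/d\rfloor - \lfloor (n-1)/d\rfloor} = 1 + M(n+1). \]
   Context: $\mu$ is the Möbius function, $\lfloor x\rfloor$ is the floor of $x$, and $M(n) = \sum_{d=1}^n \mu(d)$ is the Mertens function. -}

module Defs where

open import Data.Nat using (ℕ; zero; suc; _+_; _*_; _∸_; _^_; _/_; NonZero)
open import Data.Nat.Divisibility using (_∣_; _∣?_)
open import Data.Nat.Primality using (Prime; prime?)
open import Data.Integer as ℤ using (ℤ; +_)
open import Data.List using (List; filter; length)
open import Data.Bool.ListAction using (any)
open import Data.List.Base using (upTo)
open import Data.Bool using (if_then_else_)
open import Relation.Nullary.Decidable using (⌊_⌋; _×-dec_)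

primeDivisors : ℕ → List ℕ
primeDivisors d = filter (λ p → prime? p ×-dec (p ∣? d)) (upTo (suc d))

-- Möbius function (for d ≥ 1):
--   μ(d) = 0 if p² ∣ d for some prime p,
--   μ(d) = (-1)^k if d is a product of k distinct primes.
-- (μ 0 is irrelevant; by this definition it is 0.)
μ : ℕ → ℤ
μ d = if any (λ p → ⌊ (p * p) ∣? d ⌋) (primeDivisors d)
      then + 0
      else (ℤ.- (+ 1)) ℤ.^ length (primeDivisors d)

-- Σ_{d=1}^{n} f d   (f may use that d ≠ 0, e.g. to divide by d)
sumFrom1 : ℕ → ((d : ℕ) → .{{NonZero d}} → ℤ) → ℤ
sumFrom1 zero    f = + 0
sumFrom1 (suc n) f = sumFrom1 n f ℤ.+ f (suc n)

M : ℕ → ℤ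
M n = sumFrom1 n (λ d → μ d)

-- For d ≥ 1 the exponent ⌊(n+1)/d⌋ − ⌊(n−1)/d⌋ is [d ∣ n] + [d ∣ n+1], and d divides both n
-- and n+1 only when d = 1, so 2 to that power is 1 + [d ∣ n] + [d ∣ n+1] + [d ∣ 1]. Summing
-- against μ gives M(n+1) + Σ_{d∣n} μ(d) + Σ_{d∣n+1} μ(d) + μ(1), and the two divisor sums
-- vanish because n and n+1 exceed 1. To see Σ_{d∣m} μ(d) = 0, write m = pK with p prime: the
-- divisors p e of m contribute −μ(e) when p ∤ e and 0 when p ∣ e, which cancels the divisors
-- of m prime to p, namely the divisors of K prime to p.

module Submission where

open import Defs
open import Data.Nat
  using (ℕ; zero; suc; _+_; _*_; _∸_; _^_; _/_; _%_; _<_; _≤_; s≤s; z≤n; z<s; NonZero; >-nonZero)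
open import Data.Nat.Properties
open import Data.Nat.DivMod
  using (m≡m%n+[m/n]*n; m%n<n; m<n⇒m/n≡0; n/n≡1; +-distrib-/-∣ʳ; m*n/n≡m)
open import Data.Nat.Divisibility
open import Data.Nat.Coprimality using (Coprime; coprime-divisor)
open import Data.Nat.Primality
  using (Prime; prime?; prime⇒irreducible; prime⇒nonZero; ¬prime[1]; euclidsLemma; productOfPrimes≢0)
open import Data.Nat.Primality.Factorisation using (factorise)
open import Data.Nat.ListAction using (product)
open import Data.Integer as ℤ using (ℤ; +_)
import Data.Integer.Properties as ℤ
open import Data.Integer.Tactic.RingSolver using (solve)
open import Algebra.Properties.CommutativeSemigroup ℤ.+-commutativeSemigroup using (interchange)
open import Data.Bool using (Bool; T; if_then_else_)
open import Data.Bool.Properties using (T-≡; ¬-not)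
open import Data.Bool.ListAction using (any)
open import Data.List using (_∷_; []; _++_; _∷ʳ_; filter; length; upTo)
open import Data.List.Properties
  using (filter-≐; filter-++; filter-accept; filter-reject; length-++; upTo-∷ʳ)
import Data.List.Relation.Unary.All as All
open import Data.List.Relation.Unary.Any.Properties using (any⁺; any⁻)
open import Data.List.Membership.Propositional using (_∈_; lose; find)
open import Data.List.Membership.Propositional.Properties using (∈-filter⁺; ∈-filter⁻; ∈-upTo⁺)
open import Data.Empty using (⊥)
open import Data.Sum using (_⊎_; inj₁; inj₂)
open import Data.Product using (_×_; _,_; proj₁; proj₂; ∃-syntax)
open import Function using (_∘_)
open import Function.Bundles using (Equivalence)
open import Relation.Unary using (Pred; Decidable)
open import Relation.Unary.Properties using (_∪?_)
open import Relation.Nullary using (¬_; Dec; yes; no; contradiction)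
open import Relation.Nullary.Decidable using (T?; ¬?; ⌊_⌋; _×-dec_; toWitness; fromWitness)
open import Relation.Binary.PropositionalEquality

-- Ignoring the NonZero argument of sumFrom1 makes M n equal to ∑ n μ by definition.
∑ : ℕ → (ℕ → ℤ) → ℤ
∑ n f = sumFrom1 n (λ d → f d)

sumFrom1-cong : ∀ n {f g : (d : ℕ) → .{{NonZero d}} → ℤ} →
                (∀ d → f (suc d) ≡ g (suc d)) → sumFrom1 n f ≡ sumFrom1 n g
sumFrom1-cong zero    f≗g = refl
sumFrom1-cong (suc n) f≗g = cong₂ ℤ._+_ (sumFrom1-cong n f≗g) (f≗g n)

∑-cong : ∀ n {f g : ℕ → ℤ} → (∀ d → f (suc d) ≡ g (suc d)) → ∑ n f ≡ ∑ n g
∑-cong n = sumFrom1-cong n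

∑-distrib-+ : ∀ n (f g : ℕ → ℤ) → ∑ n (λ d → f d ℤ.+ g d) ≡ ∑ n f ℤ.+ ∑ n g
∑-distrib-+ zero    f g = refl
∑-distrib-+ (suc n) f g =
  trans (cong (ℤ._+ (f (suc n) ℤ.+ g (suc n))) (∑-distrib-+ n f g))
        (interchange (∑ n f) (∑ n g) (f (suc n)) (g (suc n)))

∑-distrib-neg : ∀ n (f : ℕ → ℤ) → ∑ n (λ d → ℤ.- f d) ≡ ℤ.- ∑ n f
∑-distrib-neg zero    f = refl
∑-distrib-neg (suc n) f =
  trans (cong (ℤ._+ ℤ.- f (suc n)) (∑-distrib-neg n f)) (sym (ℤ.neg-distrib-+ (∑ n f) (f (suc n))))

∑-split : ∀ m n (f : ℕ → ℤ) → ∑ (m + n) f ≡ ∑ m f ℤ.+ ∑ n (λ j → f (m + j))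
∑-split m zero    f = trans (cong (λ k → ∑ k f) (+-identityʳ m)) (sym (ℤ.+-identityʳ (∑ m f)))
∑-split m (suc n) f rewrite +-suc m n =
  trans (cong (ℤ._+ f (suc (m + n))) (∑-split m n f)) (ℤ.+-assoc (∑ m f) _ _)

∑-vanishing-tail : ∀ {m} n (f : ℕ → ℤ) → m ≤ n → (∀ d → m < d → d ≤ n → f d ≡ + 0) →
                   ∑ n f ≡ ∑ m f
∑-vanishing-tail zero    f z≤n tail = refl
∑-vanishing-tail {m} (suc n) f m≤1+n tail with m≤n⇒m<n∨m≡n m≤1+n
... | inj₂ refl = refl
... | inj₁ (s≤s m≤n) = begin
  ∑ n f ℤ.+ f (suc n)
    ≡⟨ cong₂ ℤ._+_ (∑-vanishing-tail n f m≤n (λ d m<d d≤n → tail d m<d (m≤n⇒m≤1+n d≤n)))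
                   (tail (suc n) (s≤s m≤n) ≤-refl) ⟩
  ∑ m f ℤ.+ + 0
    ≡⟨ ℤ.+-identityʳ (∑ m f) ⟩
  ∑ m f ∎
  where open ≡-Reasoning

infixr 7 [_]*_

[_]*_ : ∀ {a} {A : Set a} → Dec A → ℤ → ℤ
[ yes _ ]* x = x
[ no  _ ]* x = + 0

[]*-accept : ∀ {a} {A : Set a} (a? : Dec A) {x : ℤ} → A → [ a? ]* x ≡ x
[]*-accept (yes _) _ = refl
[]*-accept (no ¬a) a = contradiction a ¬a

[]*-reject : ∀ {a} {A : Set a} (a? : Dec A) {x : ℤ} → ¬ A → [ a? ]* x ≡ + 0
[]*-reject (yes a) ¬a = contradiction a ¬a
[]*-reject (no _)  _  = refl

[]*-zero : ∀ {a} {A : Set a} (a? : Dec A) → [ a? ]* + 0 ≡ + 0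
[]*-zero (yes _) = refl
[]*-zero (no _)  = refl

[]*-cong : ∀ {a b} {A : Set a} {B : Set b} (a? : Dec A) (b? : Dec B) {x : ℤ} →
           (A → B) → (B → A) → [ a? ]* x ≡ [ b? ]* x
[]*-cong (yes _) (yes _) _   _   = refl
[]*-cong (yes a) (no ¬b) a→b _   = contradiction (a→b a) ¬b
[]*-cong (no ¬a) (yes b) _   b→a = contradiction (b→a b) ¬a
[]*-cong (no _)  (no _)  _   _   = refl

[]*-split : ∀ {a} {A : Set a} (a? : Dec A) (x : ℤ) → x ≡ [ a? ]* x ℤ.+ [ ¬? a? ]* x
[]*-split (yes _) x = sym (ℤ.+-identityʳ x)
[]*-split (no _)  x = sym (ℤ.+-identityˡ x)

∑-multiples : ∀ p K .{{_ : NonZero p}} (f : ℕ → ℤ) →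
              ∑ (p * K) (λ d → [ p ∣? d ]* f d) ≡ ∑ K (λ e → f (p * e))
∑-multiples p zero f rewrite *-zeroʳ p = refl
∑-multiples p@(suc p-1) (suc K) f = begin
  ∑ (p * suc K) g
    ≡⟨ cong (λ n → ∑ n g) p*[1+K]≡p*K+p ⟩
  ∑ (p * K + p) g
    ≡⟨ ∑-split (p * K) p g ⟩
  ∑ (p * K) g ℤ.+ ∑ p (λ j → g (p * K + j))
    ≡⟨ cong₂ ℤ._+_ (∑-multiples p K f) last-block ⟩
  ∑ K (λ e → f (p * e)) ℤ.+ f (p * K + p)
    ≡⟨ cong (λ n → ∑ K (λ e → f (p * e)) ℤ.+ f n) p*[1+K]≡p*K+p ⟨
  ∑ (suc K) (λ e → f (p * e)) ∎
  where
  open ≡-Reasoning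
  g : ℕ → ℤ
  g d = [ p ∣? d ]* f d
  p*[1+K]≡p*K+p : p * suc K ≡ p * K + p
  p*[1+K]≡p*K+p = trans (*-suc p K) (+-comm p (p * K))
  p∤p*K+j : ∀ j → 0 < j → j < p → ¬ p ∣ p * K + j
  p∤p*K+j j@(suc _) _ j<p p∣ = <⇒≱ j<p (∣⇒≤ (∣m+n∣m⇒∣n p∣ (m∣m*n K)))
  last-block : ∑ p (λ j → g (p * K + j)) ≡ f (p * K + p)
  last-block = begin
    ∑ p-1 (λ j → g (p * K + j)) ℤ.+ g (p * K + p)
      ≡⟨ cong₂ ℤ._+_ (∑-vanishing-tail p-1 _ z≤n
                       (λ j 0<j j≤p-1 → []*-reject (p ∣? (p * K + j)) (p∤p*K+j j 0<j (s≤s j≤p-1))))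
                     ([]*-accept (p ∣? (p * K + p)) (∣m∣n⇒∣m+n (m∣m*n K) ∣-refl)) ⟩
    + 0 ℤ.+ f (p * K + p)
      ≡⟨ ℤ.+-identityˡ _ ⟩
    f (p * K + p) ∎

divisorSum : ℕ → (ℕ → ℤ) → ℤ
divisorSum m f = ∑ m (λ d → [ d ∣? m ]* f d)

∑-divisors : ∀ {m} n .{{_ : NonZero m}} (f : ℕ → ℤ) → m ≤ n →
             ∑ n (λ d → [ d ∣? m ]* f d) ≡ divisorSum m f
∑-divisors {m} n f m≤n = ∑-vanishing-tail n _ m≤n
  (λ d m<d _ → []*-reject (d ∣? m) (λ d∣m → <⇒≱ m<d (∣⇒≤ d∣m)))

[1+m]/n-cases : ∀ m n .{{_ : NonZero n}} →
                (n ∣ suc m × suc m / n ≡ suc (m / n)) ⊎ (¬ n ∣ suc m × suc m / n ≡ m / n)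
[1+m]/n-cases m n = cases (m≤n⇒m<n∨m≡n (m%n<n m n))
  where
  r = m % n
  q = m / n
  1+m≡1+r+q*n : suc m ≡ suc r + q * n
  1+m≡1+r+q*n = cong suc (m≡m%n+[m/n]*n m n)
  [1+m]/n≡[1+r]/n+q : suc m / n ≡ suc r / n + q
  [1+m]/n≡[1+r]/n+q = trans (cong (_/ n) 1+m≡1+r+q*n)
                        (trans (+-distrib-/-∣ʳ (suc r) (n∣m*n q)) (cong (λ k → suc r / n + k) (m*n/n≡m q n)))
  cases : suc r < n ⊎ suc r ≡ n → (n ∣ suc m × suc m / n ≡ suc q) ⊎ (¬ n ∣ suc m × suc m / n ≡ q)
  cases (inj₂ 1+r≡n) = inj₁ (n∣1+m , trans [1+m]/n≡[1+r]/n+q (cong (_+ q) [1+r]/n≡1))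
    where
    n∣1+m : n ∣ suc m
    n∣1+m = subst (n ∣_) (sym 1+m≡1+r+q*n) (∣m∣n⇒∣m+n (subst (n ∣_) (sym 1+r≡n) ∣-refl) (n∣m*n q))
    [1+r]/n≡1 : suc r / n ≡ 1
    [1+r]/n≡1 = trans (cong (_/ n) 1+r≡n) (n/n≡1 n)
  cases (inj₁ 1+r<n) = inj₂ (n∤1+m , trans [1+m]/n≡[1+r]/n+q (cong (_+ q) (m<n⇒m/n≡0 1+r<n)))
    where
    n∤1+m : ¬ n ∣ suc m
    n∤1+m n∣1+m = <⇒≱ 1+r<n (∣⇒≤ (∣m+n∣m⇒∣n n∣q*n+1+r (n∣m*n q)))
      where
      n∣q*n+1+r : n ∣ q * n + suc r
      n∣q*n+1+r = subst (n ∣_) (trans 1+m≡1+r+q*n (+-comm (suc r) (q * n))) n∣1+m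

doubling-weight : ∀ m d .{{_ : NonZero d}} (x : ℤ) →
                  x ℤ.* + 2 ^ (suc (suc m) / d ∸ m / d)
                    ≡ x ℤ.+ [ d ∣? suc m ]* x ℤ.+ [ d ∣? suc (suc m) ]* x ℤ.+ [ d ∣? 1 ]* x
doubling-weight m d x with [1+m]/n-cases m d | [1+m]/n-cases (suc m) d
... | inj₁ (d∣1+m , e₁) | inj₁ (d∣2+m , e₂)
  rewrite e₂ | e₁ | m+n∸n≡m 2 (m / d)
        | []*-accept (d ∣? suc m) {x} d∣1+m | []*-accept (d ∣? suc (suc m)) {x} d∣2+m
        | []*-accept (d ∣? 1) {x} (∣m+n∣m⇒∣n (subst (d ∣_) (+-comm 1 (suc m)) d∣2+m) d∣1+m)
  = solve (x ∷ [])
... | inj₁ (d∣1+m , e₁) | inj₂ (d∤2+m , e₂)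
  rewrite e₂ | e₁ | m+n∸n≡m 1 (m / d)
        | []*-accept (d ∣? suc m) {x} d∣1+m | []*-reject (d ∣? suc (suc m)) {x} d∤2+m
        | []*-reject (d ∣? 1) {x} (λ d∣1 → d∤2+m (∣-trans d∣1 (1∣ _)))
  = solve (x ∷ [])
... | inj₂ (d∤1+m , e₁) | inj₁ (d∣2+m , e₂)
  rewrite e₂ | e₁ | m+n∸n≡m 1 (m / d)
        | []*-reject (d ∣? suc m) {x} d∤1+m | []*-accept (d ∣? suc (suc m)) {x} d∣2+m
        | []*-reject (d ∣? 1) {x} (λ d∣1 → d∤1+m (∣-trans d∣1 (1∣ _)))
  = solve (x ∷ [])
... | inj₂ (d∤1+m , e₁) | inj₂ (d∤2+m , e₂)
  rewrite e₂ | e₁ | n∸n≡0 (m / d)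
        | []*-reject (d ∣? suc m) {x} d∤1+m | []*-reject (d ∣? suc (suc m)) {x} d∤2+m
        | []*-reject (d ∣? 1) {x} (λ d∣1 → d∤1+m (∣-trans d∣1 (1∣ _)))
  = solve (x ∷ [])

module _ {a p q} {A : Set a} {P : Pred A p} {Q : Pred A q} (P? : Decidable P) (Q? : Decidable Q) where

  length-filter-∪ : (∀ {x} → P x → Q x → ⊥) → ∀ xs →
                    length (filter (P? ∪? Q?) xs) ≡ length (filter P? xs) + length (filter Q? xs)
  length-filter-∪ disjoint []       = refl
  length-filter-∪ disjoint (x ∷ xs) with P? x | Q? x
  ... | yes px | yes qx = contradiction qx (disjoint px)
  ... | yes _  | no _   = cong suc (length-filter-∪ disjoint xs)
  ... | no _   | yes _  = trans (cong suc (length-filter-∪ disjoint xs)) (sym (+-suc _ _))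
  ... | no _   | no _   = length-filter-∪ disjoint xs

module _ {p} {P : Pred ℕ p} (P? : Decidable P) where

  count : ℕ → ℕ
  count n = length (filter P? (upTo n))

  count-suc : ∀ n → count (suc n) ≡ count n + length (filter P? (n ∷ []))
  count-suc n = begin
    length (filter P? (upTo (suc n)))
      ≡⟨ cong (length ∘ filter P?) (upTo-∷ʳ n) ⟨
    length (filter P? (upTo n ∷ʳ n))
      ≡⟨ cong length (filter-++ P? (upTo n) (n ∷ [])) ⟩
    length (filter P? (upTo n) ++ filter P? (n ∷ []))
      ≡⟨ length-++ (filter P? (upTo n)) ⟩
    length (filter P? (upTo n)) + length (filter P? (n ∷ [])) ∎
    where open ≡-Reasoning

  count-vanishing-tail : ∀ {m} n → m ≤ n → (∀ x → m ≤ x → x < n → ¬ P x) → count n ≡ count m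
  count-vanishing-tail zero    z≤n tail = refl
  count-vanishing-tail {m} (suc n) m≤1+n tail with m≤n⇒m<n∨m≡n m≤1+n
  ... | inj₂ refl = refl
  ... | inj₁ (s≤s m≤n) = begin
    count (suc n)
      ≡⟨ count-suc n ⟩
    count n + length (filter P? (n ∷ []))
      ≡⟨ cong₂ _+_ (count-vanishing-tail n m≤n (λ x m≤x x<n → tail x m≤x (m<n⇒m<1+n x<n)))
                   (cong length (filter-reject P? (tail n m≤n ≤-refl))) ⟩
    count m + 0
      ≡⟨ +-identityʳ (count m) ⟩
    count m ∎
    where open ≡-Reasoning

count-≡ : ∀ {m n} → m < n → count (_≟ m) n ≡ 1
count-≡ {m} {n} m<n = begin
  count (_≟ m) n
    ≡⟨ count-vanishing-tail (_≟ m) n m<n (λ x m<x _ x≡m → <-irrefl (sym x≡m) m<x) ⟩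
  count (_≟ m) (suc m)
    ≡⟨ count-suc (_≟ m) m ⟩
  count (_≟ m) m + length (filter (_≟ m) (m ∷ []))
    ≡⟨ cong₂ _+_ (count-vanishing-tail (_≟ m) m z≤n (λ x _ x<m x≡m → <-irrefl x≡m x<m))
                 (cong length (filter-accept (_≟ m) refl)) ⟩
  1 ∎
  where open ≡-Reasoning

prime∣prime⇒≡ : ∀ {p q} → Prime p → Prime q → q ∣ p → q ≡ p
prime∣prime⇒≡ pp pq q∣p with prime⇒irreducible pp q∣p
... | inj₁ refl = contradiction pq ¬prime[1]
... | inj₂ q≡p  = q≡p

primeDivisor? : ∀ n → Decidable (λ p → Prime p × p ∣ n)
primeDivisor? n p = prime? p ×-dec (p ∣? n)

∈-primeDivisors⁺ : ∀ {p n} .{{_ : NonZero n}} → Prime p → p ∣ n → p ∈ primeDivisors n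
∈-primeDivisors⁺ pp p∣n = ∈-filter⁺ (primeDivisor? _) (∈-upTo⁺ (s≤s (∣⇒≤ p∣n))) (pp , p∣n)

∈-primeDivisors⁻ : ∀ {p n} → p ∈ primeDivisors n → Prime p × p ∣ n
∈-primeDivisors⁻ {n = n} p∈ = proj₂ (∈-filter⁻ (primeDivisor? n) {xs = upTo (suc n)} p∈)

ω : ℕ → ℕ
ω n = length (primeDivisors n)

ω-*-prime : ∀ {p n} .{{_ : NonZero n}} → Prime p → ¬ p ∣ n → ω (p * n) ≡ suc (ω n)
ω-*-prime {p} {n} pp p∤n = begin
  ω (p * n)
    ≡⟨ cong length (filter-≐ (primeDivisor? (p * n)) (primeDivisor? n ∪? (_≟ p)) (to , from)
                              (upTo (suc (p * n)))) ⟩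
  length (filter (primeDivisor? n ∪? (_≟ p)) (upTo (suc (p * n))))
    ≡⟨ length-filter-∪ (primeDivisor? n) (_≟ p) (λ { (_ , q∣n) refl → p∤n q∣n }) (upTo (suc (p * n))) ⟩
  count (primeDivisor? n) (suc (p * n)) + count (_≟ p) (suc (p * n))
    ≡⟨ cong₂ _+_ (count-vanishing-tail (primeDivisor? n) (suc (p * n)) (s≤s (m≤n*m n p))
                   (λ q n<q _ (_ , q∣n) → <⇒≱ n<q (∣⇒≤ q∣n)))
                 (count-≡ (s≤s (m≤m*n p n))) ⟩
  ω n + 1
    ≡⟨ +-comm (ω n) 1 ⟩
  suc (ω n) ∎
  where
  open ≡-Reasoning
  instance _ = prime⇒nonZero pp
  to : ∀ {q} → Prime q × q ∣ p * n → (Prime q × q ∣ n) ⊎ q ≡ p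
  to (pq , q∣pn) with euclidsLemma p n pq q∣pn
  ... | inj₁ q∣p = inj₂ (prime∣prime⇒≡ pp pq q∣p)
  ... | inj₂ q∣n = inj₁ (pq , q∣n)
  from : ∀ {q} → (Prime q × q ∣ n) ⊎ q ≡ p → Prime q × q ∣ p * n
  from (inj₁ (pq , q∣n)) = pq , ∣n⇒∣m*n p q∣n
  from (inj₂ refl)       = pp , m∣m*n n

hasSquareFactor : ℕ → Bool
hasSquareFactor n = any (λ p → ⌊ p * p ∣? n ⌋) (primeDivisors n)

hasSquareFactor⁺ : ∀ {p n} .{{_ : NonZero n}} → Prime p → p * p ∣ n → T (hasSquareFactor n)
hasSquareFactor⁺ {p} pp p²∣n =
  any⁺ _ (lose (∈-primeDivisors⁺ pp (∣-trans (m∣m*n p) p²∣n)) (fromWitness p²∣n))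

hasSquareFactor⁻ : ∀ {n} → T (hasSquareFactor n) → ∃[ p ] Prime p × p * p ∣ n
hasSquareFactor⁻ {n} t with find (any⁻ _ (primeDivisors n) t)
... | p , p∈ , p²∣n = p , proj₁ (∈-primeDivisors⁻ {n = n} p∈) , toWitness p²∣n

μ-squarefull : ∀ {p n} .{{_ : NonZero n}} → Prime p → p * p ∣ n → μ n ≡ + 0
μ-squarefull {n = n} pp p²∣n =
  cong (λ b → if b then + 0 else ℤ.-1ℤ ℤ.^ ω n) (Equivalence.to T-≡ (hasSquareFactor⁺ pp p²∣n))

μ-squarefree : ∀ {n} → ¬ T (hasSquareFactor n) → μ n ≡ ℤ.-1ℤ ℤ.^ ω n
μ-squarefree {n} ¬t =
  cong (λ b → if b then + 0 else ℤ.-1ℤ ℤ.^ ω n) (¬-not (¬t ∘ Equivalence.from T-≡))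

square∣*prime⇒square∣ : ∀ {p q n} → Prime p → ¬ p ∣ n → Prime q → q * q ∣ p * n → q * q ∣ n
square∣*prime⇒square∣ {p} {q} pp p∤n pq q²∣pn with q ≟ p
... | yes refl = contradiction (*-cancelˡ-∣ p {{prime⇒nonZero pp}} q²∣pn) p∤n
... | no q≢p   = coprime-divisor q²⊥p q²∣pn
  where
  q²⊥p : Coprime (q * q) p
  q²⊥p (i∣q² , i∣p) with prime⇒irreducible pp i∣p
  ... | inj₁ i≡1 = i≡1
  ... | inj₂ refl with euclidsLemma q q pp i∣q²
  ...   | inj₁ p∣q = contradiction (sym (prime∣prime⇒≡ pq pp p∣q)) q≢p
  ...   | inj₂ p∣q = contradiction (sym (prime∣prime⇒≡ pq pp p∣q)) q≢p

μ-*-prime : ∀ {p n} .{{_ : NonZero n}} → Prime p → ¬ p ∣ n → μ (p * n) ≡ ℤ.- μ n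
μ-*-prime {p} {n} pp p∤n with T? (hasSquareFactor n)
... | yes t = let q , pq , q²∣n = hasSquareFactor⁻ {n} t in
  trans (μ-squarefull {{m*n≢0 p n {{prime⇒nonZero pp}}}} pq (∣n⇒∣m*n p q²∣n))
        (cong ℤ.-_ (sym (μ-squarefull pq q²∣n)))
... | no ¬t = begin
  μ (p * n)                 ≡⟨ μ-squarefree {p * n} (¬t ∘ squarefree-lift) ⟩
  ℤ.-1ℤ ℤ.^ ω (p * n)       ≡⟨ cong (ℤ.-1ℤ ℤ.^_) (ω-*-prime pp p∤n) ⟩
  ℤ.-1ℤ ℤ.* ℤ.-1ℤ ℤ.^ ω n   ≡⟨ ℤ.-1*i≡-i _ ⟩
  ℤ.- (ℤ.-1ℤ ℤ.^ ω n)       ≡⟨ cong ℤ.-_ (μ-squarefree {n} ¬t) ⟨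
  ℤ.- μ n                   ∎
  where
  open ≡-Reasoning
  squarefree-lift : T (hasSquareFactor (p * n)) → T (hasSquareFactor n)
  squarefree-lift t = let q , pq , q²∣pn = hasSquareFactor⁻ {p * n} t in
    hasSquareFactor⁺ pq (square∣*prime⇒square∣ pp p∤n pq q²∣pn)

prime∤⇒coprime : ∀ {p n} → Prime p → ¬ p ∣ n → Coprime n p
prime∤⇒coprime pp p∤n (i∣n , i∣p) with prime⇒irreducible pp i∣p
... | inj₁ i≡1 = i≡1
... | inj₂ refl = contradiction i∣n p∤n

divisorSum-μ-*-prime : ∀ {p} K .{{_ : NonZero K}} → Prime p → divisorSum (p * K) μ ≡ + 0
divisorSum-μ-*-prime {p} K pp = begin
  ∑ n (λ d → [ d ∣? n ]* μ d)
    ≡⟨ ∑-cong n (λ d → []*-split (p ∣? suc d) _) ⟩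
  ∑ n (λ d → [ p ∣? d ]* [ d ∣? n ]* μ d ℤ.+ [ ¬? (p ∣? d) ]* [ d ∣? n ]* μ d)
    ≡⟨ ∑-distrib-+ n _ _ ⟩
  ∑ n (λ d → [ p ∣? d ]* [ d ∣? n ]* μ d) ℤ.+ ∑ n (λ d → [ ¬? (p ∣? d) ]* [ d ∣? n ]* μ d)
    ≡⟨ cong₂ ℤ._+_ (∑-multiples p K _) (∑-cong n coprime-part) ⟩
  ∑ K (λ e → [ p * e ∣? n ]* μ (p * e)) ℤ.+ ∑ n G
    ≡⟨ cong₂ ℤ._+_ (∑-cong K multiple-part) (∑-vanishing-tail n G (m≤n*m K p) tail) ⟩
  ∑ K (λ e → ℤ.- G e) ℤ.+ ∑ K G
    ≡⟨ cong (ℤ._+ ∑ K G) (∑-distrib-neg K G) ⟩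
  ℤ.- ∑ K G ℤ.+ ∑ K G
    ≡⟨ ℤ.+-inverseˡ (∑ K G) ⟩
  + 0 ∎
  where
  open ≡-Reasoning
  instance _ = prime⇒nonZero pp
  n = p * K
  G : ℕ → ℤ
  G d = [ ¬? (p ∣? d) ]* [ d ∣? K ]* μ d
  coprime-part : ∀ d → [ ¬? (p ∣? suc d) ]* [ suc d ∣? n ]* μ (suc d) ≡ G (suc d)
  coprime-part d with p ∣? suc d
  ... | yes _   = refl
  ... | no  p∤d = []*-cong (suc d ∣? n) (suc d ∣? K) (coprime-divisor (prime∤⇒coprime pp p∤d)) (∣n⇒∣m*n p)
  multiple-part : ∀ e → [ p * suc e ∣? n ]* μ (p * suc e) ≡ ℤ.- G (suc e)
  multiple-part e with p ∣? suc e | suc e ∣? K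
  ... | yes p∣e | _ =
    trans (cong ([ p * suc e ∣? n ]*_) (μ-squarefull {{m*n≢0 p (suc e)}} pp (*-monoʳ-∣ p p∣e))) ([]*-zero _)
  ... | no  p∤e | yes e∣K = trans ([]*-accept (p * suc e ∣? n) (*-monoʳ-∣ p e∣K)) (μ-*-prime pp p∤e)
  ... | no  _   | no  e∤K = []*-reject (p * suc e ∣? n) (e∤K ∘ *-cancelˡ-∣ p)
  tail : ∀ d → K < d → d ≤ n → G d ≡ + 0
  tail d K<d _ = trans (cong ([ ¬? (p ∣? d) ]*_) ([]*-reject (d ∣? K) (<⇒≱ K<d ∘ ∣⇒≤))) ([]*-zero _)

divisorSum-μ : ∀ {m} → 1 < m → divisorSum m μ ≡ + 0
divisorSum-μ {m} 1<m with factorise m {{>-nonZero (<-trans z<s 1<m)}}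
... | record { factors = [] ; isFactorisation = m≡1 } = contradiction m≡1 (>⇒≢ 1<m)
... | record { factors = p ∷ ps ; isFactorisation = m≡p*K ; factorsPrime = pp All.∷ ps-prime } =
  subst (λ k → divisorSum k μ ≡ + 0) (sym m≡p*K)
        (divisorSum-μ-*-prime (product ps) {{productOfPrimes≢0 ps-prime}} pp)

∑-divisors-μ : ∀ {m} n → 1 < m → m ≤ n → ∑ n (λ d → [ d ∣? m ]* μ d) ≡ + 0
∑-divisors-μ n 1<m m≤n = trans (∑-divisors n {{>-nonZero (<-trans z<s 1<m)}} μ m≤n) (divisorSum-μ 1<m)

theorem4 : (n : ℕ) → 1 < n →
    sumFrom1 (suc n) (λ d → μ d ℤ.* (+ (2 ^ ((suc n / d) ∸ ((n ∸ 1) / d))))) ≡ + 1 ℤ.+ M (suc n)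
theorem4 zero ()
theorem4 n@(suc m) 1<n = begin
  sumFrom1 (suc n) (λ d → μ d ℤ.* + 2 ^ (suc n / d ∸ m / d))
    ≡⟨ sumFrom1-cong (suc n) (λ d → doubling-weight m (suc d) (μ (suc d))) ⟩
  ∑ (suc n) (λ d → μ d ℤ.+ [ d ∣? n ]* μ d ℤ.+ [ d ∣? suc n ]* μ d ℤ.+ [ d ∣? 1 ]* μ d)
    ≡⟨ ∑-distrib-+ (suc n) _ _ ⟩
  ∑ (suc n) (λ d → μ d ℤ.+ [ d ∣? n ]* μ d ℤ.+ [ d ∣? suc n ]* μ d) ℤ.+ S 1
    ≡⟨ cong (ℤ._+ S 1) (∑-distrib-+ (suc n) _ _) ⟩
  ∑ (suc n) (λ d → μ d ℤ.+ [ d ∣? n ]* μ d) ℤ.+ S (suc n) ℤ.+ S 1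
    ≡⟨ cong (λ s → s ℤ.+ S (suc n) ℤ.+ S 1) (∑-distrib-+ (suc n) _ _) ⟩
  M (suc n) ℤ.+ S n ℤ.+ S (suc n) ℤ.+ S 1
    ≡⟨ cong₂ (λ a b → M (suc n) ℤ.+ a ℤ.+ b ℤ.+ S 1)
             (∑-divisors-μ (suc n) 1<n (n≤1+n n)) (∑-divisors-μ (suc n) (m<n⇒m<1+n 1<n) ≤-refl) ⟩
  M (suc n) ℤ.+ + 0 ℤ.+ + 0 ℤ.+ S 1
    ≡⟨ cong (λ s → M (suc n) ℤ.+ + 0 ℤ.+ + 0 ℤ.+ s) (∑-divisors (suc n) μ (s≤s z≤n)) ⟩
  M (suc n) ℤ.+ + 0 ℤ.+ + 0 ℤ.+ μ 1
    ≡⟨ cong (ℤ._+ + 1) (trans (ℤ.+-identityʳ (M (suc n) ℤ.+ + 0)) (ℤ.+-identityʳ (M (suc n)))) ⟩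
  M (suc n) ℤ.+ + 1
    ≡⟨ ℤ.+-comm (M (suc n)) (+ 1) ⟩
  + 1 ℤ.+ M (suc n) ∎
  where
  open ≡-Reasoning
  S : ℕ → ℤ
  S k = ∑ (suc n) (λ d → [ d ∣? k ]* μ d)
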